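{- Let $\ell$ be a non-negative even integer and $E_\ell(x)=\sum_{j=0}^{\ell}\frac{x^j}{j!}$. Then $E_\ell(x)E_\ell(-x)\ge1$ for all $x\in\mathbb{R}$. -}

module Defs where

open import Level using (Level; _⊔_) renaming (suc to lsuc)
open import Data.Nat using (ℕ; zero; suc; _!) renaming (_+_ to _+ℕ_)

open import Data.Product using (Σ; _×_)
open import Relation.Nullary using (¬_)
open import Relation.Binary using (Rel; IsTotalOrder)
open import Relation.Unary using (Pred)
open import Algebra.Bundles using (CommutativeRing)

-- Any model of this record is isomorphic to ℝ.  The multiplicative
-- inverse is a total operation, only specified on nonzero elements.
record RealField (c ℓ₁ ℓ₂ : Level) : Set (lsuc (c ⊔ ℓ₁ ⊔ ℓ₂)) where
  field
    commutativeRing : CommutativeRing c ℓ₁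
  open CommutativeRing commutativeRing public
  field
    _≤_          : Rel Carrier ℓ₂
    isTotalOrder : IsTotalOrder _≈_ _≤_
    0≉1          : ¬ (0# ≈ 1#)
    _⁻¹          : Carrier → Carrier
    ⁻¹-inverse   : ∀ x → ¬ (x ≈ 0#) → (x * (x ⁻¹)) ≈ 1#
    +-monoˡ-≤    : ∀ {x y} z → x ≤ y → (x + z) ≤ (y + z)
    *-nonneg     : ∀ {x y} → 0# ≤ x → 0# ≤ y → 0# ≤ (x * y)
    complete     : (S : Pred Carrier c) →
                   Σ Carrier S →
                   Σ Carrier (λ b → ∀ s → S s → s ≤ b) →
                   Σ Carrier (λ u → (∀ s → S s → s ≤ u) ×
                                    (∀ b → (∀ s → S s → s ≤ b) → u ≤ b))

module _ {c ℓ₁ ℓ₂ : Level} (R : RealField c ℓ₁ ℓ₂) where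
  open RealField R

  fromℕ : ℕ → Carrier
  fromℕ zero    = 0#
  fromℕ (suc n) = 1# + fromℕ n

  pow : Carrier → ℕ → Carrier
  pow x zero    = 1#
  pow x (suc n) = x * pow x n

  E : ℕ → Carrier → Carrier
  E zero    x = 1#
  E (suc n) x = E n x + (pow x (suc n) * (fromℕ (suc n !) ⁻¹))

-- Write t n = xⁿ/n! and σ k = (−1)ᵏ.  For every ℓ,
--
--   E ℓ x · E ℓ (−x) = 1 + Σ_{1 ≤ n ≤ 2ℓ} σ ℓ (1 + σ n) C(n − 1, ℓ) t n,
--
-- by induction on ℓ: passing to m = ℓ + 1 adds t m · (E ℓ (−x) + σ m E ℓ x) + σ m (t m)²;
-- the coefficients of the first part, σ m (1 + σ n) C(n, m), combine with the old ones by
-- Pascal's rule, and the last part supplies the new top coefficient since C(2m, m) = 2 C(2m − 1, m).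
-- For even ℓ every summand is nonnegative: (1 + σ n) xⁿ vanishes for odd n and is
-- 2 (x^{n/2})² for even n.

{-# OPTIONS --safe #-}
module Submission where

open import Defs
open import Level using (Level)
open import Data.Nat using (ℕ)
open import Data.Nat.Divisibility using (_∣_; divides)

open import Data.Nat.Base using (zero; suc; pred; _!; _∸_; s≤s; z≤n)
  renaming (_+_ to _+ℕ_; _*_ to _*ℕ_; _<_ to _<ℕ_)
import Data.Nat.Properties as ℕ
open import Data.Nat.Combinatorics
  using (_C_; nCk≡n!/k![n-k]!; k![n∸k]!∣n!; nCk≡nC[n∸k]; k>n⇒nCk≡0; nCk+nC[k+1]≡[n+1]C[k+1])
open import Data.Nat.DivMod using (m/n*n≡m)
open import Data.Sum using (inj₁; inj₂)
open import Relation.Nullary using (¬_)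
open import Relation.Binary.Structures using (IsTotalOrder)
open import Relation.Binary.PropositionalEquality as ≡ using (_≡_; cong; subst)

[n+k]Ck*k!*n!≡[n+k]! : ∀ n k → ((n +ℕ k) C k) *ℕ (k ! *ℕ n !) ≡ (n +ℕ k) !
[n+k]Ck*k!*n!≡[n+k]! n k =
  subst (λ d → ((n +ℕ k) C k) *ℕ (k ! *ℕ d !) ≡ (n +ℕ k) !) (ℕ.m+n∸n≡m n k) NCk*k!*[N∸k]!≡N!
  where
  N : ℕ
  N = n +ℕ k
  instance _ = ℕ._!*_!≢0 k (N ∸ k)
  NCk*k!*[N∸k]!≡N! : (N C k) *ℕ (k ! *ℕ (N ∸ k) !) ≡ N !
  NCk*k!*[N∸k]!≡N! = ≡.trans (cong (_*ℕ (k ! *ℕ (N ∸ k) !)) (nCk≡n!/k![n-k]! (ℕ.m≤n+m k n)))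
                              (m/n*n≡m (k![n∸k]!∣n! (ℕ.m≤n+m k n)))

[2n+2]C[n+1]≡2*[2n+1]C[n+1] : ∀ n → (suc n +ℕ suc n) C suc n ≡ 2 *ℕ ((n +ℕ suc n) C suc n)
[2n+2]C[n+1]≡2*[2n+1]C[n+1] n = begin
  suc N C suc n                ≡⟨ nCk+nC[k+1]≡[n+1]C[k+1] N n ⟨
  N C n +ℕ N C suc n           ≡⟨ cong (_+ℕ N C suc n) (nCk≡nC[n∸k] (ℕ.m≤m+n n (suc n))) ⟩
  N C (N ∸ n) +ℕ N C suc n     ≡⟨ cong (λ k → N C k +ℕ N C suc n) (ℕ.m+n∸m≡n n (suc n)) ⟩
  N C suc n +ℕ N C suc n       ≡⟨ cong (N C suc n +ℕ_) (ℕ.+-identityʳ (N C suc n)) ⟨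
  2 *ℕ (N C suc n)             ∎
  where
  open ≡.≡-Reasoning
  N : ℕ
  N = n +ℕ suc n

module Expansion {c ℓ₁ ℓ₂ : Level} (R : RealField c ℓ₁ ℓ₂) where
  open RealField R
  open IsTotalOrder isTotalOrder using (total; antisym; ≤-respˡ-≈; ≤-respʳ-≈)
    renaming (trans to ≤-trans; refl to ≤-refl)
  open import Algebra.Properties.Ring ring using (-1*x≈-x; -‿distribˡ-*; -‿distribʳ-*; -‿involutive)
  open import Algebra.Properties.Semiring.Mult semiring using (_×_; ×-homo-+; ×1-homo-*)
  open import Algebra.Properties.CommutativeSemiring.Exp commutativeSemiring
    using (_^_; ^-congˡ; ^-homo-*; ^-distrib-*)
  open import Algebra.Properties.CommutativeSemigroup +-commutativeSemigroup using ()
    renaming (interchange to +-interchange)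
  open import Algebra.Properties.CommutativeSemigroup *-commutativeSemigroup using ()
    renaming (interchange to *-interchange; x∙yz≈y∙xz to x*yz≈y*xz)
  open import Algebra.Solver.Ring.NaturalCoefficients.Default commutativeSemiring
    using (solve; _:=_; _:+_; _:*_)
  open import Relation.Binary.Reasoning.Setoid setoid

  ≤-resp₂ : ∀ {x x′ y y′} → x ≈ x′ → y ≈ y′ → x ≤ y → x′ ≤ y′
  ≤-resp₂ x≈x′ y≈y′ x≤y = ≤-respʳ-≈ y≈y′ (≤-respˡ-≈ x≈x′ x≤y)

  -x*-y≈x*y : ∀ x y → - x * - y ≈ x * y
  -x*-y≈x*y x y = begin
    - x * - y     ≈⟨ -‿distribˡ-* x (- y) ⟨
    - (x * - y)   ≈⟨ -‿cong (-‿distribʳ-* x y) ⟨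
    - - (x * y)   ≈⟨ -‿involutive (x * y) ⟩
    x * y         ∎

  x≤0⇒0≤-x : ∀ {x} → x ≤ 0# → 0# ≤ (- x)
  x≤0⇒0≤-x {x} x≤0 = ≤-resp₂ (-‿inverseʳ x) (+-identityˡ (- x)) (+-monoˡ-≤ (- x) x≤0)

  0≤x*x : ∀ x → 0# ≤ (x * x)
  0≤x*x x with total 0# x
  ... | inj₁ 0≤x = *-nonneg 0≤x 0≤x
  ... | inj₂ x≤0 = ≤-respʳ-≈ (-x*-y≈x*y x x) (*-nonneg (x≤0⇒0≤-x x≤0) (x≤0⇒0≤-x x≤0))

  0≤1 : 0# ≤ 1#
  0≤1 = ≤-respʳ-≈ (*-identityˡ 1#) (0≤x*x 1#)

  1≰0 : ¬ 1# ≤ 0#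
  1≰0 1≤0 = 0≉1 (antisym 0≤1 1≤0)

  0≤x+y : ∀ {x y} → 0# ≤ x → 0# ≤ y → 0# ≤ (x + y)
  0≤x+y {x} {y} 0≤x 0≤y = ≤-trans (≤-respʳ-≈ (sym (+-identityˡ y)) 0≤y) (+-monoˡ-≤ y 0≤x)

  1≤1+x : ∀ {x} → 0# ≤ x → 1# ≤ (1# + x)
  1≤1+x {x} 0≤x = ≤-resp₂ (+-identityˡ 1#) (+-comm x 1#) (+-monoˡ-≤ 1# 0≤x)

  x*y≈1⇒x≉0 : ∀ {x y} → x * y ≈ 1# → ¬ x ≈ 0#
  x*y≈1⇒x≉0 {x} {y} xy≈1 x≈0 = 0≉1 (trans (sym (zeroˡ y)) (trans (*-congʳ (sym x≈0)) xy≈1))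

  ⁻¹-unique : ∀ {x y} → x * y ≈ 1# → y ≈ x ⁻¹
  ⁻¹-unique {x} {y} xy≈1 = begin
    y                ≈⟨ *-identityʳ y ⟨
    y * 1#           ≈⟨ *-congˡ (⁻¹-inverse x (x*y≈1⇒x≉0 xy≈1)) ⟨
    y * (x * x ⁻¹)   ≈⟨ *-assoc y x (x ⁻¹) ⟨
    (y * x) * x ⁻¹   ≈⟨ *-congʳ (trans (*-comm y x) xy≈1) ⟩
    1# * x ⁻¹        ≈⟨ *-identityˡ (x ⁻¹) ⟩
    x ⁻¹             ∎

  ⁻¹-distrib-* : ∀ {x y} → ¬ x ≈ 0# → ¬ y ≈ 0# → x ⁻¹ * y ⁻¹ ≈ (x * y) ⁻¹
  ⁻¹-distrib-* {x} {y} x≉0 y≉0 = ⁻¹-unique (begin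
    (x * y) * (x ⁻¹ * y ⁻¹)   ≈⟨ *-interchange x y (x ⁻¹) (y ⁻¹) ⟩
    (x * x ⁻¹) * (y * y ⁻¹)   ≈⟨ *-cong (⁻¹-inverse x x≉0) (⁻¹-inverse y y≉0) ⟩
    1# * 1#                   ≈⟨ *-identityˡ 1# ⟩
    1#                        ∎)

  0≤x⁻¹ : ∀ {x} → 0# ≤ x → ¬ x ≈ 0# → 0# ≤ (x ⁻¹)
  0≤x⁻¹ {x} 0≤x x≉0 = ≤-respʳ-≈ x*x⁻¹x⁻¹≈x⁻¹ (*-nonneg 0≤x (0≤x*x (x ⁻¹)))
    where
    x*x⁻¹x⁻¹≈x⁻¹ : x * (x ⁻¹ * x ⁻¹) ≈ x ⁻¹
    x*x⁻¹x⁻¹≈x⁻¹ = trans (sym (*-assoc x (x ⁻¹) (x ⁻¹)))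
                     (trans (*-congʳ (⁻¹-inverse x x≉0)) (*-identityˡ (x ⁻¹)))

  fromℕ≡×1 : ∀ n → fromℕ R n ≡ n × 1#
  fromℕ≡×1 zero    = ≡.refl
  fromℕ≡×1 (suc n) = cong (1# +_) (fromℕ≡×1 n)

  fromℕ-homo-+ : ∀ m n → fromℕ R (m +ℕ n) ≈ fromℕ R m + fromℕ R n
  fromℕ-homo-+ m n rewrite fromℕ≡×1 (m +ℕ n) | fromℕ≡×1 m | fromℕ≡×1 n = ×-homo-+ 1# m n

  fromℕ-homo-* : ∀ m n → fromℕ R (m *ℕ n) ≈ fromℕ R m * fromℕ R n
  fromℕ-homo-* m n rewrite fromℕ≡×1 (m *ℕ n) | fromℕ≡×1 m | fromℕ≡×1 n = ×1-homo-* m n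

  fromℕ-cong : ∀ {m n} → m ≡ n → fromℕ R m ≈ fromℕ R n
  fromℕ-cong m≡n = reflexive (cong (fromℕ R) m≡n)

  0≤fromℕ : ∀ n → 0# ≤ fromℕ R n
  0≤fromℕ zero    = ≤-refl
  0≤fromℕ (suc n) = 0≤x+y 0≤1 (0≤fromℕ n)

  fromℕ[1+n]≉0 : ∀ n → ¬ fromℕ R (suc n) ≈ 0#
  fromℕ[1+n]≉0 n 1+n≈0 = 1≰0 (≤-respʳ-≈ 1+n≈0 (1≤1+x (0≤fromℕ n)))

  fromℕ[n!]≉0 : ∀ n → ¬ fromℕ R (n !) ≈ 0#
  fromℕ[n!]≉0 n = subst (λ k → ¬ fromℕ R k ≈ 0#) (ℕ.suc-pred (n !)) (fromℕ[1+n]≉0 (pred (n !)))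
    where instance _ = ℕ._!≢0 n

  pow≡^ : ∀ x n → pow R x n ≡ x ^ n
  pow≡^ x zero    = ≡.refl
  pow≡^ x (suc n) = cong (x *_) (pow≡^ x n)

  pow-congˡ : ∀ {x y} n → x ≈ y → pow R x n ≈ pow R y n
  pow-congˡ {x} {y} n x≈y rewrite pow≡^ x n | pow≡^ y n = ^-congˡ n x≈y

  pow-homo-+ : ∀ x m n → pow R x (m +ℕ n) ≈ pow R x m * pow R x n
  pow-homo-+ x m n rewrite pow≡^ x (m +ℕ n) | pow≡^ x m | pow≡^ x n = ^-homo-* x m n

  pow-distrib-* : ∀ x y n → pow R (x * y) n ≈ pow R x n * pow R y n
  pow-distrib-* x y n rewrite pow≡^ (x * y) n | pow≡^ x n | pow≡^ y n = ^-distrib-* x y n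

  sgn : ℕ → Carrier
  sgn = pow R (- 1#)

  sgn-suc : ∀ n → sgn (suc n) ≈ - sgn n
  sgn-suc n = -1*x≈-x (sgn n)

  sgn-suc-suc : ∀ n → sgn (suc (suc n)) ≈ sgn n
  sgn-suc-suc n = trans (sgn-suc (suc n)) (trans (-‿cong (sgn-suc n)) (-‿involutive (sgn n)))

  sgn-homo-+ : ∀ m n → sgn (m +ℕ n) ≈ sgn m * sgn n
  sgn-homo-+ = pow-homo-+ (- 1#)

  sgn*sgn≈1 : ∀ n → sgn n * sgn n ≈ 1#
  sgn*sgn≈1 zero    = *-identityˡ 1#
  sgn*sgn≈1 (suc n) = trans (*-cong (sgn-suc n) (sgn-suc n)) (trans (-x*-y≈x*y (sgn n) (sgn n)) (sgn*sgn≈1 n))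

  sgn[n+n]≈1 : ∀ n → sgn (n +ℕ n) ≈ 1#
  sgn[n+n]≈1 n = trans (sgn-homo-+ n n) (sgn*sgn≈1 n)

  1+sgn[1+n+n]≈0 : ∀ n → 1# + sgn (suc (n +ℕ n)) ≈ 0#
  1+sgn[1+n+n]≈0 n = trans (+-congˡ (trans (sgn-suc (n +ℕ n)) (-‿cong (sgn[n+n]≈1 n)))) (-‿inverseʳ 1#)

  sgn-even : ∀ {n} → 2 ∣ n → sgn n ≈ 1#
  sgn-even (divides zero    ≡.refl) = refl
  sgn-even (divides (suc q) ≡.refl) = trans (sgn-suc-suc (q *ℕ 2)) (sgn-even (divides q ≡.refl))

  sgn-shift : ∀ j m → sgn m * (1# + sgn (j +ℕ m)) ≈ sgn j + sgn m
  sgn-shift j m = begin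
    sgn m * (1# + sgn (j +ℕ m))          ≈⟨ distribˡ (sgn m) 1# _ ⟩
    sgn m * 1# + sgn m * sgn (j +ℕ m)    ≈⟨ +-cong (*-identityʳ (sgn m)) (*-congˡ (sgn-homo-+ j m)) ⟩
    sgn m + sgn m * (sgn j * sgn m)      ≈⟨ +-congˡ (x*yz≈y*xz (sgn m) (sgn j) (sgn m)) ⟩
    sgn m + sgn j * (sgn m * sgn m)      ≈⟨ +-congˡ (trans (*-congˡ (sgn*sgn≈1 m)) (*-identityʳ (sgn j))) ⟩
    sgn m + sgn j                        ≈⟨ +-comm (sgn m) (sgn j) ⟩
    sgn j + sgn m                        ∎

  pow-neg : ∀ x n → pow R (- x) n ≈ sgn n * pow R x n
  pow-neg x n = trans (pow-congˡ n (sym (-1*x≈-x x))) (pow-distrib-* (- 1#) x n)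

  0≤[1+sgn]*pow : ∀ x n → 0# ≤ ((1# + sgn n) * pow R x n)
  0≤[1+sgn]*pow x zero          = *-nonneg (0≤x+y 0≤1 0≤1) 0≤1
  0≤[1+sgn]*pow x (suc zero)    = ≤-respʳ-≈ (sym (trans (*-congʳ (1+sgn[1+n+n]≈0 0)) (zeroˡ _))) ≤-refl
  0≤[1+sgn]*pow x (suc (suc n)) = ≤-respʳ-≈ x²-factor (*-nonneg (0≤x*x x) (0≤[1+sgn]*pow x n))
    where
    rearrange : ∀ x a p → (x * x) * (a * p) ≈ a * (x * (x * p))
    rearrange = solve 3 (λ x a p → (x :* x) :* (a :* p) := a :* (x :* (x :* p))) refl
    x²-factor : (x * x) * ((1# + sgn n) * pow R x n) ≈ (1# + sgn (suc (suc n))) * pow R x (suc (suc n))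
    x²-factor = trans (rearrange x (1# + sgn n) (pow R x n)) (*-congʳ (+-congˡ (sym (sgn-suc-suc n))))

  ∑ : ℕ → (ℕ → Carrier) → Carrier
  ∑ zero    f = 0#
  ∑ (suc n) f = ∑ n f + f n

  infix 5 ∑
  syntax ∑ n (λ k → e) = ∑[ k < n ] e

  ∑-cong : ∀ n {f g} → (∀ k → f k ≈ g k) → ∑ n f ≈ ∑ n g
  ∑-cong zero    f≈g = refl
  ∑-cong (suc n) f≈g = +-cong (∑-cong n f≈g) (f≈g n)

  ∑-+ : ∀ n f g → ∑ n f + ∑ n g ≈ ∑[ k < n ] (f k + g k)
  ∑-+ zero    f g = +-identityˡ 0#
  ∑-+ (suc n) f g = trans (+-interchange (∑ n f) (f n) (∑ n g) (g n)) (+-congʳ (∑-+ n f g))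

  ∑-distribˡ : ∀ n a f → a * ∑ n f ≈ ∑[ k < n ] (a * f k)
  ∑-distribˡ zero    a f = zeroʳ a
  ∑-distribˡ (suc n) a f = trans (distribˡ a (∑ n f) (f n)) (+-congʳ (∑-distribˡ n a f))

  ∑-distribʳ : ∀ n a f → ∑ n f * a ≈ ∑[ k < n ] (f k * a)
  ∑-distribʳ zero    a f = zeroˡ a
  ∑-distribʳ (suc n) a f = trans (distribʳ a (∑ n f) (f n)) (+-congʳ (∑-distribʳ n a f))

  ∑-vanishing : ∀ n f → (∀ k → k <ℕ n → f k ≈ 0#) → ∑ n f ≈ 0#
  ∑-vanishing zero    f f≈0 = refl
  ∑-vanishing (suc n) f f≈0 = trans (+-cong ∑≈0 (f≈0 n (ℕ.n<1+n n))) (+-identityʳ 0#)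
    where
    ∑≈0 : ∑ n f ≈ 0#
    ∑≈0 = ∑-vanishing n f (λ k k<n → f≈0 k (ℕ.m<n⇒m<1+n k<n))

  ∑-split : ∀ n a f → ∑[ k < n +ℕ a ] f k ≈ ∑ a f + (∑[ j < n ] f (j +ℕ a))
  ∑-split zero    a f = sym (+-identityʳ (∑ a f))
  ∑-split (suc n) a f = trans (+-congʳ (∑-split n a f)) (+-assoc (∑ a f) _ _)

  0≤∑ : ∀ n f → (∀ k → 0# ≤ f k) → 0# ≤ ∑ n f
  0≤∑ zero    f 0≤f = ≤-refl
  0≤∑ (suc n) f 0≤f = 0≤x+y (0≤∑ n f 0≤f) (0≤f n)

  term : Carrier → ℕ → Carrier
  term x n = pow R x n * fromℕ R (n !) ⁻¹

  term-zero : ∀ x → term x 0 ≈ 1#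
  term-zero x = trans (*-identityˡ _) (sym (⁻¹-unique (trans (*-identityʳ _) (+-identityʳ 1#))))

  term-neg : ∀ x n → term (- x) n ≈ sgn n * term x n
  term-neg x n = trans (*-congʳ (pow-neg x n)) (*-assoc (sgn n) (pow R x n) _)

  term-*-term : ∀ x n k → term x n * term x k ≈ fromℕ R ((n +ℕ k) C k) * term x (n +ℕ k)
  term-*-term x n k = begin
    (pow R x n * n!⁻¹) * (pow R x k * k!⁻¹)   ≈⟨ *-interchange _ _ _ _ ⟩
    (pow R x n * pow R x k) * (n!⁻¹ * k!⁻¹)   ≈⟨ *-cong (sym (pow-homo-+ x n k)) n!⁻¹k!⁻¹≈binom/[n+k]! ⟩
    pow R x (n +ℕ k) * (binom * [n+k]!⁻¹)     ≈⟨ x*yz≈y*xz _ _ _ ⟩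
    binom * term x (n +ℕ k)                   ∎
    where
    binom n!⁻¹ k!⁻¹ [n+k]!⁻¹ : Carrier
    binom = fromℕ R ((n +ℕ k) C k)
    n!⁻¹ = fromℕ R (n !) ⁻¹
    k!⁻¹ = fromℕ R (k !) ⁻¹
    [n+k]!⁻¹ = fromℕ R ((n +ℕ k) !) ⁻¹
    k!n!*binom/[n+k]!≈1 : (fromℕ R (k !) * fromℕ R (n !)) * (binom * [n+k]!⁻¹) ≈ 1#
    k!n!*binom/[n+k]!≈1 = begin
      (fromℕ R (k !) * fromℕ R (n !)) * (binom * [n+k]!⁻¹)
        ≈⟨ x*yz≈y*xz _ _ _ ⟩
      binom * ((fromℕ R (k !) * fromℕ R (n !)) * [n+k]!⁻¹)
        ≈⟨ *-assoc _ _ _ ⟨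
      (binom * (fromℕ R (k !) * fromℕ R (n !))) * [n+k]!⁻¹
        ≈⟨ *-congʳ (*-congˡ (fromℕ-homo-* (k !) (n !))) ⟨
      (binom * fromℕ R (k ! *ℕ n !)) * [n+k]!⁻¹
        ≈⟨ *-congʳ (fromℕ-homo-* ((n +ℕ k) C k) (k ! *ℕ n !)) ⟨
      fromℕ R (((n +ℕ k) C k) *ℕ (k ! *ℕ n !)) * [n+k]!⁻¹
        ≈⟨ *-congʳ (fromℕ-cong ([n+k]Ck*k!*n!≡[n+k]! n k)) ⟩
      fromℕ R ((n +ℕ k) !) * [n+k]!⁻¹
        ≈⟨ ⁻¹-inverse _ (fromℕ[n!]≉0 (n +ℕ k)) ⟩
      1# ∎
    n!⁻¹k!⁻¹≈binom/[n+k]! : n!⁻¹ * k!⁻¹ ≈ binom * [n+k]!⁻¹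
    n!⁻¹k!⁻¹≈binom/[n+k]! = begin
      n!⁻¹ * k!⁻¹                          ≈⟨ *-comm _ _ ⟩
      k!⁻¹ * n!⁻¹                          ≈⟨ ⁻¹-distrib-* (fromℕ[n!]≉0 k) (fromℕ[n!]≉0 n) ⟩
      (fromℕ R (k !) * fromℕ R (n !)) ⁻¹    ≈⟨ ⁻¹-unique k!n!*binom/[n+k]!≈1 ⟨
      binom * [n+k]!⁻¹                     ∎

  E≈∑term : ∀ ℓ x → E R ℓ x ≈ ∑[ j < suc ℓ ] term x j
  E≈∑term zero    x = trans (sym (term-zero x)) (sym (+-identityˡ (term x 0)))
  E≈∑term (suc ℓ) x = +-congʳ (E≈∑term ℓ x)

  productCoeff : ℕ → ℕ → Carrier
  productCoeff ℓ zero    = 0#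
  productCoeff ℓ (suc k) = sgn ℓ * ((1# + sgn (suc k)) * fromℕ R (k C ℓ))

  crossCoeff : ℕ → ℕ → Carrier
  crossCoeff m n = sgn m * ((1# + sgn n) * fromℕ R (n C m))

  crossCoeff-vanishing : ∀ {m n} → n <ℕ m → crossCoeff m n ≈ 0#
  crossCoeff-vanishing {m} {n} n<m = begin
    sgn m * ((1# + sgn n) * fromℕ R (n C m))  ≈⟨ *-congˡ (*-congˡ (fromℕ-cong (k>n⇒nCk≡0 n<m))) ⟩
    sgn m * ((1# + sgn n) * 0#)               ≈⟨ *-congˡ (zeroʳ _) ⟩
    sgn m * 0#                                ≈⟨ zeroʳ _ ⟩
    0#                                        ∎

  productCoeff-pascal : ∀ ℓ n → productCoeff ℓ n + crossCoeff (suc ℓ) n ≈ productCoeff (suc ℓ) n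
  productCoeff-pascal ℓ zero    = trans (+-identityˡ _) (crossCoeff-vanishing {suc ℓ} (s≤s z≤n))
  productCoeff-pascal ℓ (suc k) = begin
    s * (a * p) + sgn (suc ℓ) * (a * fromℕ R (suc k C suc ℓ))
      ≈⟨ +-congˡ (*-cong (sgn-suc ℓ) (*-congˡ (fromℕ-cong (≡.sym (nCk+nC[k+1]≡[n+1]C[k+1] k ℓ))))) ⟩
    s * (a * p) + - s * (a * fromℕ R (k C ℓ +ℕ k C suc ℓ))
      ≈⟨ +-congˡ (*-congˡ (*-congˡ (fromℕ-homo-+ (k C ℓ) (k C suc ℓ)))) ⟩
    s * (a * p) + - s * (a * (p + q))
      ≈⟨ +-congˡ (trans (*-congˡ (distribˡ a p q)) (distribˡ (- s) (a * p) (a * q))) ⟩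
    s * (a * p) + (- s * (a * p) + - s * (a * q))
      ≈⟨ +-assoc _ _ _ ⟨
    (s * (a * p) + - s * (a * p)) + - s * (a * q)
      ≈⟨ +-congʳ (trans (+-congˡ (sym (-‿distribˡ-* s (a * p)))) (-‿inverseʳ (s * (a * p)))) ⟩
    0# + - s * (a * q)
      ≈⟨ +-identityˡ _ ⟩
    - s * (a * q)
      ≈⟨ *-congʳ (sgn-suc ℓ) ⟨
    sgn (suc ℓ) * (a * q) ∎
    where
    s a p q : Carrier
    s = sgn ℓ
    a = 1# + sgn (suc k)
    p = fromℕ R (k C ℓ)
    q = fromℕ R (k C suc ℓ)

  productCoeff-odd-top : ∀ ℓ → productCoeff ℓ (suc (ℓ +ℕ ℓ)) ≈ 0#
  productCoeff-odd-top ℓ = trans (*-congˡ (trans (*-congʳ (1+sgn[1+n+n]≈0 ℓ)) (zeroˡ _))) (zeroʳ (sgn ℓ))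

  productCoeff-top : ∀ ℓ →
    sgn (suc ℓ) * fromℕ R ((suc ℓ +ℕ suc ℓ) C suc ℓ) ≈ productCoeff (suc ℓ) (suc ℓ +ℕ suc ℓ)
  productCoeff-top ℓ = *-congˡ (begin
    fromℕ R ((suc ℓ +ℕ suc ℓ) C suc ℓ)      ≡⟨ cong (fromℕ R) ([2n+2]C[n+1]≡2*[2n+1]C[n+1] ℓ) ⟩
    fromℕ R (2 *ℕ k)                        ≈⟨ fromℕ-homo-* 2 k ⟩
    (1# + (1# + 0#)) * fromℕ R k             ≈⟨ *-congʳ (+-congˡ (+-identityʳ 1#)) ⟩
    (1# + 1#) * fromℕ R k                    ≈⟨ *-congʳ (+-congˡ (sgn[n+n]≈1 (suc ℓ))) ⟨
    (1# + sgn (suc ℓ +ℕ suc ℓ)) * fromℕ R k  ∎)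
    where
    k : ℕ
    k = (ℓ +ℕ suc ℓ) C suc ℓ

  0≤productCoeff*term : ∀ {ℓ} → 2 ∣ ℓ → ∀ x n → 0# ≤ (productCoeff ℓ n * term x n)
  0≤productCoeff*term 2∣ℓ x zero          = ≤-respʳ-≈ (sym (zeroˡ (term x 0))) ≤-refl
  0≤productCoeff*term {ℓ} 2∣ℓ x (suc k) =
    ≤-respʳ-≈ regroup (*-nonneg (0≤[1+sgn]*pow x (suc k)) (*-nonneg (0≤fromℕ (k C ℓ)) 0≤[1+k]!⁻¹))
    where
    0≤[1+k]!⁻¹ : 0# ≤ (fromℕ R (suc k !) ⁻¹)
    0≤[1+k]!⁻¹ = 0≤x⁻¹ (0≤fromℕ (suc k !)) (fromℕ[n!]≉0 (suc k))
    a b : Carrier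
    a = 1# + sgn (suc k)
    b = fromℕ R (k C ℓ)
    regroup : (a * pow R x (suc k)) * (b * fromℕ R (suc k !) ⁻¹) ≈ productCoeff ℓ (suc k) * term x (suc k)
    regroup = begin
      (a * pow R x (suc k)) * (b * fromℕ R (suc k !) ⁻¹)  ≈⟨ *-interchange _ _ _ _ ⟩
      (a * b) * term x (suc k)                           ≈⟨ *-congʳ (*-identityˡ (a * b)) ⟨
      (1# * (a * b)) * term x (suc k)                    ≈⟨ *-congʳ (*-congʳ (sgn-even 2∣ℓ)) ⟨
      productCoeff ℓ (suc k) * term x (suc k)            ∎

  cross-terms : ∀ ℓ m x →
    (E R ℓ (- x) + sgn m * E R ℓ x) * term x m ≈ ∑[ n < suc ℓ +ℕ m ] crossCoeff m n * term x n
  cross-terms ℓ m x = begin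
    (E R ℓ (- x) + sgn m * E R ℓ x) * term x m
      ≈⟨ *-congʳ (+-cong (E≈∑term ℓ (- x)) (*-congˡ (E≈∑term ℓ x))) ⟩
    ((∑[ j < suc ℓ ] term (- x) j) + sgn m * (∑[ j < suc ℓ ] term x j)) * term x m
      ≈⟨ *-congʳ (trans (+-congˡ (∑-distribˡ (suc ℓ) (sgn m) (term x))) (∑-+ (suc ℓ) _ _)) ⟩
    (∑[ j < suc ℓ ] (term (- x) j + sgn m * term x j)) * term x m
      ≈⟨ ∑-distribʳ (suc ℓ) (term x m) _ ⟩
    ∑[ j < suc ℓ ] ((term (- x) j + sgn m * term x j) * term x m)
      ≈⟨ ∑-cong (suc ℓ) summand ⟩
    ∑[ j < suc ℓ ] f (j +ℕ m)
      ≈⟨ +-identityˡ _ ⟨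
    0# + (∑[ j < suc ℓ ] f (j +ℕ m))
      ≈⟨ +-congʳ (∑-vanishing m f (λ n n<m → trans (*-congʳ (crossCoeff-vanishing n<m)) (zeroˡ _))) ⟨
    ∑ m f + (∑[ j < suc ℓ ] f (j +ℕ m))
      ≈⟨ ∑-split (suc ℓ) m f ⟨
    ∑[ n < suc ℓ +ℕ m ] f n ∎
    where
    f : ℕ → Carrier
    f n = crossCoeff m n * term x n
    summand : ∀ j → (term (- x) j + sgn m * term x j) * term x m ≈ f (j +ℕ m)
    summand j = begin
      (term (- x) j + sgn m * term x j) * term x m
        ≈⟨ *-congʳ (trans (+-congʳ (term-neg x j)) (sym (distribʳ (term x j) (sgn j) (sgn m)))) ⟩
      ((sgn j + sgn m) * term x j) * term x m
        ≈⟨ *-assoc _ _ _ ⟩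
      (sgn j + sgn m) * (term x j * term x m)
        ≈⟨ *-cong (sym (sgn-shift j m)) (term-*-term x j m) ⟩
      (sgn m * (1# + sgn (j +ℕ m))) * (fromℕ R ((j +ℕ m) C m) * term x (j +ℕ m))
        ≈⟨ *-assoc _ _ _ ⟩
      sgn m * ((1# + sgn (j +ℕ m)) * (fromℕ R ((j +ℕ m) C m) * term x (j +ℕ m)))
        ≈⟨ *-congˡ (*-assoc _ _ _) ⟨
      sgn m * (((1# + sgn (j +ℕ m)) * fromℕ R ((j +ℕ m) C m)) * term x (j +ℕ m))
        ≈⟨ *-assoc _ _ _ ⟨
      f (j +ℕ m) ∎

  E*E-neg-expansion : ∀ ℓ x →
    E R ℓ x * E R ℓ (- x) ≈ 1# + (∑[ n < suc (ℓ +ℕ ℓ) ] productCoeff ℓ n * term x n)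
  E*E-neg-expansion zero    x =
    trans (*-identityˡ 1#) (sym (trans (+-congˡ (trans (+-identityˡ _) (zeroˡ _))) (+-identityʳ 1#)))
  E*E-neg-expansion (suc ℓ) x = begin
    (A + T) * (B + term (- x) m)
      ≈⟨ *-congˡ (+-congˡ (term-neg x m)) ⟩
    (A + T) * (B + σ * T)
      ≈⟨ expand A B T σ ⟩
    A * B + ((B + σ * A) * T + σ * (T * T))
      ≈⟨ +-cong (E*E-neg-expansion ℓ x) (+-cong (cross-terms ℓ m x) (*-congˡ (term-*-term x m m))) ⟩
    (1# + ∑ (suc (ℓ +ℕ ℓ)) (f ℓ)) + (∑ N cross + σ * (fromℕ R (N C m) * term x N))
      ≈⟨ trans (+-assoc _ _ _) (+-congˡ (sym (+-assoc _ _ _))) ⟩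
    1# + ((∑ (suc (ℓ +ℕ ℓ)) (f ℓ) + ∑ N cross) + σ * (fromℕ R (N C m) * term x N))
      ≈⟨ +-congˡ (+-cong (+-congʳ extend) (trans (sym (*-assoc _ _ _)) (*-congʳ (productCoeff-top ℓ)))) ⟩
    1# + ((∑ N (f ℓ) + ∑ N cross) + f m N)
      ≈⟨ +-congˡ (+-congʳ (trans (∑-+ N (f ℓ) cross) (∑-cong N pascal))) ⟩
    1# + (∑ N (f m) + f m N) ∎
    where
    m N : ℕ
    m = suc ℓ
    N = m +ℕ m
    σ A B T : Carrier
    σ = sgn m
    A = E R ℓ x
    B = E R ℓ (- x)
    T = term x m
    f : ℕ → ℕ → Carrier
    f ℓ n = productCoeff ℓ n * term x n
    cross : ℕ → Carrier
    cross n = crossCoeff m n * term x n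
    expand : ∀ A B T σ → (A + T) * (B + σ * T) ≈ A * B + ((B + σ * A) * T + σ * (T * T))
    expand = solve 4 (λ A B T σ → (A :+ T) :* (B :+ σ :* T) := A :* B :+ ((B :+ σ :* A) :* T :+ σ :* (T :* T))) refl
    extend : ∑ (suc (ℓ +ℕ ℓ)) (f ℓ) ≈ ∑ N (f ℓ)
    extend = begin
      ∑ (suc (ℓ +ℕ ℓ)) (f ℓ)
        ≈⟨ +-identityʳ _ ⟨
      ∑ (suc (ℓ +ℕ ℓ)) (f ℓ) + 0#
        ≈⟨ +-congˡ (trans (*-congʳ (productCoeff-odd-top ℓ)) (zeroˡ _)) ⟨
      ∑ (suc (ℓ +ℕ ℓ)) (f ℓ) + f ℓ (suc (ℓ +ℕ ℓ))
        ≡⟨ cong (λ k → ∑ (suc k) (f ℓ)) (ℕ.+-suc ℓ ℓ) ⟨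
      ∑ N (f ℓ) ∎
    pascal : ∀ n → f ℓ n + cross n ≈ f m n
    pascal n = trans (sym (distribʳ (term x n) _ _)) (*-congʳ (productCoeff-pascal ℓ n))

lemma5p1 : {c ℓ₁ ℓ₂ : Level} (R : RealField c ℓ₁ ℓ₂) (ℓ : ℕ) → 2 ∣ ℓ → (x : RealField.Carrier R) → RealField._≤_ R (RealField.1# R) (RealField._*_ R (E R ℓ x) (E R ℓ (RealField.-_ R x)))
lemma5p1 R ℓ 2∣ℓ x =
  ≤-respʳ-≈ (sym (E*E-neg-expansion ℓ x))
            (1≤1+x (0≤∑ (suc (ℓ +ℕ ℓ)) _ (0≤productCoeff*term 2∣ℓ x)))
  where
  open RealField R using (sym)
  open IsTotalOrder (RealField.isTotalOrder R) using (≤-respʳ-≈)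
  open Expansion R
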